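{- Let $G$ be a finite simple weighted graph with weight function $w:EG\to\{1,2,3,\dots\}$, and let $k$ be a positive integer with $k\ge \max_{e\in EG} w_e$. For $\theta\in\mathbb{R}^{VG}$ define $\theta^\sigma\in\mathbb{R}^{VG\times\mathbb{Z}_k}$ by $\theta^\sigma_{(u,i)}=\theta_u$ for all $(u,i)\in VG\times\mathbb{Z}_k$. Then $\theta$ is an equilibrium of the (weighted) homogeneous Kuramoto model on $G$ if and only if $\theta^\sigma$ is an equilibrium of the (unweighted) homogeneous Kuramoto model on the $k$-spinning $S_k(G)$.
   Context: For a weighted graph $G$ with weights $w_{uv}$, the homogeneous Kuramoto model on $G$ is the system $\dot\theta_v=\sum_{u\in G_v} w_{uv}\sin(\theta_u-\theta_v)$, $v\in VG$, where $G_v$ is the set of neighbours of $v$; an unweighted graph is treated as having all weights equal to $1$. A point $\theta$ is an equilibrium if $\sum_{u\in G_v} w_{uv}\sin(\theta_u-\theta_v)=0$ for every $v\in VG$. Write $\mathbb{N}_h=\{0,1,\dots,h-1\}$. The $k$-spinning $S_k(G)$ (for $k\ge\max w$) is the simple unweighted graph with vertex set $VG\times\mathbb{Z}_k$ defined as follows: fix an orientation $u\to v$ of each edge $uv\in EG$; then $(u,i)$ and $(v,j)$ are adjacent iff $j-i\in\mathbb{N}_{w_{uv}}\pmod k$; in addition $(u,i)$ and $(u,j)$ are adjacent for all $u$ and all $i\neq j$ (each fiber $\{u\}\times\mathbb{Z}_k$ is a complete graph). Thus each $(u,i)$ has exactly $w_{uv}$ neighbours in the fiber of each neighbour $v$ of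 $u$. -}

module Defs where

open import Level using (Level)
open import Data.Nat using (ℕ; zero; suc; _+_; _∸_; _<_; _≤_; NonZero)
open import Data.Nat.DivMod using (_%_)
open import Data.Fin using (Fin; toℕ)
open import Data.Bool using (Bool; true; false; not; if_then_else_)
open import Data.Product using (_×_)
open import Relation.Nullary using (¬_; does)
open import Relation.Binary.PropositionalEquality using (_≡_; _≢_)
open import Algebra.Bundles using (CommutativeRing)
import Algebra.Properties.Monoid.Sum as MonoidSum
import Algebra.Definitions.RawMonoid as RawMonoidDefs
import Data.Nat as ℕ
import Data.Fin as F

-- A finite simple weighted graph on the vertex set Fin n, encoded by a
-- weight function w : Fin n → Fin n → ℕ, where w u v = 0 means "uv is not
-- an edge" and w u v ≥ 1 is the (positive integer) weight of the edge uv.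
record WeightedGraph (n : ℕ) : Set where
  field
    w     : Fin n → Fin n → ℕ
    w-sym : ∀ u v → w u v ≡ w v u
    w-irr : ∀ u → w u u ≡ 0
open WeightedGraph public

-- An orientation of the edges: for u ≠ v exactly one of u→v, v→u is chosen.
-- (ori u v ≡ true means the edge uv is oriented u → v.)
IsOrientation : {n : ℕ} → (Fin n → Fin n → Bool) → Set
IsOrientation {n} ori = ∀ (u v : Fin n) → u ≢ v → ori v u ≡ not (ori u v)

diffMod : (k : ℕ) .{{_ : NonZero k}} → Fin k → Fin k → ℕ
diffMod k i j = (toℕ j + (k ∸ toℕ i)) % k

-- Adjacency in the k-spinning S_k(G) (a simple unweighted graph on Fin n × Fin k)
-- w.r.t. the orientation ori:
--  * (u,i) ~ (u,j) iff i ≠ j   (each fiber is complete)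
--  * for u ≠ v with u → v:  (u,i) ~ (v,j) iff (j - i) mod k ∈ ℕ_{w u v}
--  * for u ≠ v with v → u:  (u,i) ~ (v,j) iff (i - j) mod k ∈ ℕ_{w u v}
spinAdj : {n : ℕ} (G : WeightedGraph n) (ori : Fin n → Fin n → Bool)
          (k : ℕ) .{{_ : NonZero k}} → Fin n × Fin k → Fin n × Fin k → Bool
spinAdj G ori k (u Data.Product., i) (v Data.Product., j) with does (u F.≟ v)
... | true  = not (does (i F.≟ j))
... | false = if ori u v
                then does (diffMod k i j ℕ.<? w G u v)
                else does (diffMod k j i ℕ.<? w G u v)

module Kuramoto {c ℓ : Level} (R : CommutativeRing c ℓ)
                (sin : CommutativeRing.Carrier R → CommutativeRing.Carrier R) where
  open CommutativeRing R
  open MonoidSum (+-monoid) using (sum)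
  open RawMonoidDefs (+-rawMonoid) using () renaming (_×_ to _·_)

  IsEquilibrium : {n : ℕ} → WeightedGraph n → (Fin n → Carrier) → Set ℓ
  IsEquilibrium {n} G θ =
    ∀ (v : Fin n) → sum (λ u → w G u v · sin (θ u - θ v)) ≈ 0#

  IsSpinEquilibrium : {n : ℕ} (G : WeightedGraph n) (ori : Fin n → Fin n → Bool)
                      (k : ℕ) .{{_ : NonZero k}} → (Fin n × Fin k → Carrier) → Set ℓ
  IsSpinEquilibrium {n} G ori k φ =
    ∀ (x : Fin n × Fin k) →
      sum (λ (u : Fin n) → sum (λ (i : Fin k) →
        if spinAdj G ori k (u Data.Product., i) x
          then sin (φ (u Data.Product., i) - φ x)
          else 0#)) ≈ 0#

  lift : {n k : ℕ} → (Fin n → Carrier) → (Fin n × Fin k → Carrier)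
  lift θ (u Data.Product., i) = θ u

-- Under the lift θ^σ every term sin(θ^σ_y − θ^σ_x) contributed by the fiber of
-- u at x = (v , j) equals sin(θ_u − θ_v), so the spinning sum at (v , j) is
-- Σ_u d_u · sin(θ_u − θ_v) with d_u the number of neighbours of (v , j) in the
-- fiber of u. For u ≠ v this is the number of i ∈ ℤ_k with (j − i) mod k, or
-- (i − j) mod k, below w_uv; both maps are bijections of ℤ_k and w_uv ≤ k, so
-- d_u = w_uv. The fiber of v itself only contributes sin 0 = 0 = w_vv · sin 0.
-- Hence the spinning equations at (v , j) are, for every j, the weighted
-- equation at v.
module Submission where

open import Defs
open import Level using (Level)
open import Data.Nat using (ℕ; _≤_; NonZero)
open import Data.Fin using (Fin)
open import Data.Bool using (Bool)
open import Data.Product using (_×_)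
open import Function.Bundles using (_⇔_)
open import Algebra.Bundles using (CommutativeRing)

open import Data.Nat as ℕ using (zero; suc; _+_; _∸_; z≤n; s≤s)
import Data.Nat.Properties as ℕ
open import Data.Nat.DivMod
open import Data.Fin as Fin using (toℕ; fromℕ<)
import Data.Fin.Properties as Fin
open import Data.Fin.Permutation using (Permutation; permutation; _⟨$⟩ʳ_; _∘ₚ_)
open import Data.Bool using (true; false; if_then_else_)
open import Data.Product using (_,_)
open import Relation.Nullary using (Dec; does; yes; no; contradiction)
open import Relation.Binary.PropositionalEquality as ≡ using (_≡_; _≢_)
open import Function.Bundles using (mk⇔)
import Relation.Binary.Reasoning.Setoid as ≈-Reasoning
open import Algebra.Bundles using (CommutativeMonoid)
import Algebra.Properties.Monoid.Sum as MonoidSum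
import Algebra.Properties.CommutativeMonoid.Sum as CommutativeMonoidSum
import Algebra.Definitions.RawMonoid as RawMonoidDefinitions

module _ {k : ℕ} .{{_ : NonZero k}} where

  rotate : ℕ → Fin k → Fin k
  rotate c i = fromℕ< (m%n<n (toℕ i + c) k)

  toℕ-rotate : ∀ c i → toℕ (rotate c i) ≡ (toℕ i + c) % k
  toℕ-rotate c i = Fin.toℕ-fromℕ< (m%n<n (toℕ i + c) k)

  [m%k+n]%k≡[m+n]%k : ∀ m n → (m % k + n) % k ≡ (m + n) % k
  [m%k+n]%k≡[m+n]%k m n = begin
    (m % k + n) % k           ≡⟨ %-distribˡ-+ (m % k) n k ⟩
    (m % k % k + n % k) % k   ≡⟨ ≡.cong (λ t → (t + n % k) % k) (m%n%n≡m%n m k) ⟩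
    (m % k + n % k) % k       ≡⟨ %-distribˡ-+ m n k ⟨
    (m + n) % k               ∎
    where open ≡.≡-Reasoning

  rotate-inverse : ∀ c d → c + d ≡ k → ∀ i → rotate d (rotate c i) ≡ i
  rotate-inverse c d c+d≡k i = Fin.toℕ-injective (begin
    toℕ (rotate d (rotate c i))   ≡⟨ toℕ-rotate d (rotate c i) ⟩
    (toℕ (rotate c i) + d) % k    ≡⟨ ≡.cong (λ t → (t + d) % k) (toℕ-rotate c i) ⟩
    ((toℕ i + c) % k + d) % k     ≡⟨ [m%k+n]%k≡[m+n]%k (toℕ i + c) d ⟩
    (toℕ i + c + d) % k           ≡⟨ ≡.cong (_% k) (ℕ.+-assoc (toℕ i) c d) ⟩
    (toℕ i + (c + d)) % k         ≡⟨ ≡.cong (λ t → (toℕ i + t) % k) c+d≡k ⟩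
    (toℕ i + k) % k               ≡⟨ [m+n]%n≡m%n (toℕ i) k ⟩
    toℕ i % k                     ≡⟨ m<n⇒m%n≡m (Fin.toℕ<n i) ⟩
    toℕ i                         ∎)
    where open ≡.≡-Reasoning

  rotation : ∀ c → c ≤ k → Permutation k k
  rotation c c≤k = permutation (rotate c) (rotate (k ∸ c))
    (rotate-inverse (k ∸ c) c (≡.trans (ℕ.+-comm (k ∸ c) c) (ℕ.m+[n∸m]≡n c≤k)))
    (rotate-inverse c (k ∸ c) (ℕ.m+[n∸m]≡n c≤k))

  negate : Fin k → Fin k
  negate i = fromℕ< (m%n<n (k ∸ toℕ i) k)

  toℕ-negate : ∀ i → toℕ (negate i) ≡ (k ∸ toℕ i) % k
  toℕ-negate i = Fin.toℕ-fromℕ< (m%n<n (k ∸ toℕ i) k)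

  negate-involutive : ∀ i → negate (negate i) ≡ i
  negate-involutive Fin.zero = Fin.toℕ-injective (begin
    toℕ (negate (negate Fin.zero))        ≡⟨ toℕ-negate (negate Fin.zero) ⟩
    (k ∸ toℕ (negate Fin.zero)) % k       ≡⟨ ≡.cong (λ t → (k ∸ t) % k) (≡.trans (toℕ-negate Fin.zero) (n%n≡0 k)) ⟩
    k % k                                 ≡⟨ n%n≡0 k ⟩
    0                                     ∎)
    where open ≡.≡-Reasoning
  negate-involutive i@(Fin.suc i-1) = Fin.toℕ-injective (begin
    toℕ (negate (negate i))       ≡⟨ toℕ-negate (negate i) ⟩
    (k ∸ toℕ (negate i)) % k      ≡⟨ ≡.cong (λ t → (k ∸ t) % k) (≡.trans (toℕ-negate i) (m<n⇒m%n≡m k∸i<k)) ⟩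
    (k ∸ (k ∸ toℕ i)) % k         ≡⟨ ≡.cong (_% k) (ℕ.m∸[m∸n]≡n (Fin.toℕ≤n i)) ⟩
    toℕ i % k                     ≡⟨ m<n⇒m%n≡m (Fin.toℕ<n i) ⟩
    toℕ i                         ∎)
    where
    open ≡.≡-Reasoning
    k∸i<k : k ∸ toℕ i ℕ.< k
    k∸i<k = ℕ.∸-monoʳ-< {k} {toℕ i} {0} (s≤s z≤n) (Fin.toℕ≤n i)

  negation : Permutation k k
  negation = permutation negate negate negate-involutive negate-involutive

  diffMod≡toℕ-rotate-negate : ∀ i j → diffMod k i j ≡ toℕ (rotate (toℕ j) (negate i))
  diffMod≡toℕ-rotate-negate i j = ≡.sym (begin
    toℕ (rotate (toℕ j) (negate i))     ≡⟨ toℕ-rotate (toℕ j) (negate i) ⟩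
    (toℕ (negate i) + toℕ j) % k        ≡⟨ ≡.cong (λ t → (t + toℕ j) % k) (toℕ-negate i) ⟩
    ((k ∸ toℕ i) % k + toℕ j) % k       ≡⟨ [m%k+n]%k≡[m+n]%k (k ∸ toℕ i) (toℕ j) ⟩
    (k ∸ toℕ i + toℕ j) % k             ≡⟨ ≡.cong (_% k) (ℕ.+-comm (k ∸ toℕ i) (toℕ j)) ⟩
    diffMod k i j                       ∎)
    where open ≡.≡-Reasoning

  diffMod≡toℕ-rotate : ∀ i j → diffMod k j i ≡ toℕ (rotate (k ∸ toℕ j) i)
  diffMod≡toℕ-rotate i j = ≡.sym (toℕ-rotate (k ∸ toℕ j) i)

module _ {a ℓ} (M : CommutativeMonoid a ℓ) where
  open CommutativeMonoid M
  open MonoidSum monoid using (sum; sum-replicate-zero)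
  open CommutativeMonoidSum M using (sum-permute)
  open RawMonoidDefinitions rawMonoid using () renaming (_×_ to _·_)

  sum-if-toℕ< : ∀ k w → w ≤ k → (x : Carrier) →
                sum {k} (λ i → if does (toℕ i ℕ.<? w) then x else ε) ≈ w · x
  sum-if-toℕ< zero    zero    _         x = refl
  sum-if-toℕ< (suc k) zero    _         x = sum-replicate-zero (suc k)
  sum-if-toℕ< (suc k) (suc w) (s≤s w≤k) x = ∙-congˡ (sum-if-toℕ< k w w≤k x)

  sum-if-toℕ∘π< : ∀ {k} (π : Permutation k k) w → w ≤ k → (x : Carrier) →
                  sum (λ i → if does (toℕ (π ⟨$⟩ʳ i) ℕ.<? w) then x else ε) ≈ w · x
  sum-if-toℕ∘π< {k} π w w≤k x =
    trans (sym (sum-permute (λ i → if does (toℕ i ℕ.<? w) then x else ε) π))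
          (sum-if-toℕ< k w w≤k x)

module _ {c ℓ : Level} (R : CommutativeRing c ℓ)
    (sin : CommutativeRing.Carrier R → CommutativeRing.Carrier R)
    (sin-cong : ∀ {x y} → CommutativeRing._≈_ R x y → CommutativeRing._≈_ R (sin x) (sin y))
    (sin0≈0 : CommutativeRing._≈_ R (sin (CommutativeRing.0# R)) (CommutativeRing.0# R)) where
  open CommutativeRing R
  open MonoidSum +-monoid using (sum; sum-cong-≋; sum-cong-≗; sum-replicate-zero)
  open RawMonoidDefinitions +-rawMonoid using () renaming (_×_ to _·_)
  open Kuramoto R sin

  module _ {n : ℕ} (G : WeightedGraph n) (k : ℕ) .{{_ : NonZero k}}
           (w≤k : ∀ (u v : Fin n) → w G u v ≤ k)
           (ori : Fin n → Fin n → Bool) where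

    SpinFiberSum : Fin n → Fin n → Fin k → Carrier → Carrier
    SpinFiberSum u v j x = sum (λ i → if spinAdj G ori k (u , i) (v , j) then x else 0#)

    spinFiberSum-≢ : ∀ {u v} → u ≢ v → ∀ j x → SpinFiberSum u v j x ≈ w G u v · x
    spinFiberSum-≢ {u} {v} u≢v j x with u Fin.≟ v
    ... | yes u≡v = contradiction u≡v u≢v
    ... | no _ with ori u v
    ...   | true = begin
      sum (λ i → if does (diffMod k i j ℕ.<? w G u v) then x else 0#)
        ≡⟨ sum-cong-≗ (λ i → ≡.cong (λ d → if does (d ℕ.<? w G u v) then x else 0#)
                                     (diffMod≡toℕ-rotate-negate i j)) ⟩
      sum (λ i → if does (toℕ (i↦j-i ⟨$⟩ʳ i) ℕ.<? w G u v) then x else 0#)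
        ≈⟨ sum-if-toℕ∘π< +-commutativeMonoid i↦j-i (w G u v) (w≤k u v) x ⟩
      w G u v · x ∎
      where
      open ≈-Reasoning setoid
      i↦j-i : Permutation k k
      i↦j-i = negation ∘ₚ rotation (toℕ j) (Fin.toℕ≤n j)
    ...   | false = begin
      sum (λ i → if does (diffMod k j i ℕ.<? w G u v) then x else 0#)
        ≡⟨ sum-cong-≗ (λ i → ≡.cong (λ d → if does (d ℕ.<? w G u v) then x else 0#)
                                     (diffMod≡toℕ-rotate i j)) ⟩
      sum (λ i → if does (toℕ (i↦i-j ⟨$⟩ʳ i) ℕ.<? w G u v) then x else 0#)
        ≈⟨ sum-if-toℕ∘π< +-commutativeMonoid i↦i-j (w G u v) (w≤k u v) x ⟩
      w G u v · x ∎
      where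
      open ≈-Reasoning setoid
      i↦i-j : Permutation k k
      i↦i-j = rotation (k ∸ toℕ j) (ℕ.m∸n≤m k (toℕ j))

    module _ (θ : Fin n → Carrier) where

      spinFiberSum-self : ∀ u j → SpinFiberSum u u j (sin (θ u - θ u)) ≈ w G u u · sin (θ u - θ u)
      spinFiberSum-self u j = begin
        SpinFiberSum u u j (sin (θ u - θ u))  ≈⟨ sum-cong-≋ (λ i → if-≈0 (spinAdj G ori k (u , i) (u , j))) ⟩
        sum {k} (λ _ → 0#)                    ≈⟨ sum-replicate-zero k ⟩
        0#                                    ≡⟨ ≡.cong (_· sin (θ u - θ u)) (w-irr G u) ⟨
        w G u u · sin (θ u - θ u)             ∎
        where
        open ≈-Reasoning setoid
        if-≈0 : ∀ b → (if b then sin (θ u - θ u) else 0#) ≈ 0#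
        if-≈0 true  = trans (sin-cong (-‿inverseʳ (θ u))) sin0≈0
        if-≈0 false = refl

      spinFiberSum-sin : ∀ u v j → SpinFiberSum u v j (sin (θ u - θ v)) ≈ w G u v · sin (θ u - θ v)
      spinFiberSum-sin u v j = by-cases (u Fin.≟ v)
        where
        by-cases : Dec (u ≡ v) → SpinFiberSum u v j (sin (θ u - θ v)) ≈ w G u v · sin (θ u - θ v)
        by-cases (yes u≡v) = ≡.subst (λ v → SpinFiberSum u v j (sin (θ u - θ v)) ≈ w G u v · sin (θ u - θ v))
                                     u≡v (spinFiberSum-self u j)
        by-cases (no u≢v)  = spinFiberSum-≢ u≢v j (sin (θ u - θ v))

      spinSum-lift≈weightedSum : ∀ v j →
        sum (λ u → sum (λ i → if spinAdj G ori k (u , i) (v , j)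
                                then sin (lift θ (u , i) - lift θ (v , j)) else 0#))
        ≈ sum (λ u → w G u v · sin (θ u - θ v))
      spinSum-lift≈weightedSum v j = sum-cong-≋ (λ u → spinFiberSum-sin u v j)

      isEquilibrium⇔isSpinEquilibrium-lift : IsEquilibrium G θ ⇔ IsSpinEquilibrium G ori k (lift θ)
      isEquilibrium⇔isSpinEquilibrium-lift = mk⇔
        (λ eq (v , j) → trans (spinSum-lift≈weightedSum v j) (eq v))
        (λ spin-eq v → trans (sym (spinSum-lift≈weightedSum v (index₀ k))) (spin-eq (v , index₀ k)))
        where
        index₀ : ∀ m .{{_ : NonZero m}} → Fin m
        index₀ (suc _) = Fin.zero

-- The orientation need not be consistent: for either choice of u → v or v → u,
-- (v , j) has w_uv neighbours in the fiber of u.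
proposition1 : ∀ {c ℓ : Level} (R : CommutativeRing c ℓ)
    (sin : CommutativeRing.Carrier R → CommutativeRing.Carrier R) →
    (∀ {x y} → CommutativeRing._≈_ R x y → CommutativeRing._≈_ R (sin x) (sin y)) →
    CommutativeRing._≈_ R (sin (CommutativeRing.0# R)) (CommutativeRing.0# R) →
    {n : ℕ} (G : WeightedGraph n) (k : ℕ) .{{_ : NonZero k}} →
    (∀ (u v : Fin n) → w G u v ≤ k) →
    (ori : Fin n → Fin n → Bool) → IsOrientation ori →
    (θ : Fin n → CommutativeRing.Carrier R) →
    Kuramoto.IsEquilibrium R sin G θ ⇔ Kuramoto.IsSpinEquilibrium R sin G ori k (Kuramoto.lift R sin θ)
proposition1 R sin sin-cong sin0≈0 G k w≤k ori _ =
  isEquilibrium⇔isSpinEquilibrium-lift R sin sin-cong sin0≈0 G k w≤k ori
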